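{- Let $G$ be a finite tree and let $m,r,s$ be positive integers (with $s$ allowed to be any nonnegative integer). If $s\ge\lfloor r/m\rfloor$, then the spies win the game ${\rm RS}(G,m,r,s)$.
   Context: The game ${\rm RS}(G,m,r,s)$ is played on a graph $G$ by a team of $r$ revolutionaries and a team of $s$ spies. First the revolutionaries, then the spies, take positions at vertices (several players may share a vertex). In each subsequent round, each revolutionary may move to an adjacent vertex or stay put, and then each spy has the same option; all positions are known to everyone. A meeting is a set of at least $m$ revolutionaries on one vertex; it is unguarded if no spy is at that vertex. The revolutionaries win if at the end of some round (including the initial placement) there is an unguarded meeting; the spies win if they can prevent this forever. -}

module Defs where

open import Data.Nat using (ℕ; suc; _≤_)
open import Data.Fin using (Fin; _≟_)
open import Data.List using (List; []; _∷_; _++_; length; filter; allFin)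
open import Data.List.Relation.Unary.Linked using (Linked)
open import Data.List.Relation.Unary.Unique.Propositional using (Unique)
open import Data.Product using (Σ; _×_)
open import Data.Sum using (_⊎_)
open import Relation.Binary.PropositionalEquality using (_≡_; _≢_)
open import Relation.Nullary using (¬_)

record Graph (n : ℕ) : Set₁ where
  field
    Adj     : Fin n → Fin n → Set
    sym     : ∀ {u v} → Adj u v → Adj v u
    irrefl  : ∀ {u} → ¬ Adj u u
open Graph public

module _ {n : ℕ} (G : Graph n) where

  data Walk : Fin n → Fin n → Set where
    here : ∀ {u} → Walk u u
    step : ∀ {u w v} → Adj G u w → Walk w v → Walk u v

  Connected : Set
  Connected = ∀ u v → Walk u v

  HasCycle : Set
  HasCycle = Σ (Fin n) λ v → Σ (List (Fin n)) λ rest →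
    (2 ≤ length rest) × Unique (v ∷ rest) × Linked (Adj G) (v ∷ rest ++ v ∷ [])

  IsTree : Set
  IsTree = (1 ≤ n) × Connected × ¬ HasCycle

Pos : ℕ → ℕ → Set
Pos n r = Fin r → Fin n

module _ {n : ℕ} (G : Graph n) where

  Step : ∀ {k} → Pos n k → Pos n k → Set
  Step p p' = ∀ i → (p' i ≡ p i) ⊎ Adj G (p i) (p' i)

countAt : ∀ {n r} → Pos n r → Fin n → ℕ
countAt {r = r} R v = length (filter (λ i → R i ≟ v) (allFin r))

UnguardedMeeting : ∀ {n r s} → ℕ → Pos n r → Pos n s → Set
UnguardedMeeting {n} m R S = Σ (Fin n) λ v → (m ≤ countAt R v) × (∀ j → S j ≢ v)

-- The spies win RS(G,m,r,s): there is a set W of positions (revolutionaries R, spies S)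
-- such that every initial placement of the revolutionaries can be answered by a spy
-- placement in W, no position in W has an unguarded meeting, and from every position
-- in W, every move of the revolutionaries can be answered by a move of the spies
-- staying inside W. (A spy winning strategy for this safety game.)
SpiesWin : ∀ {n} → Graph n → (m r s : ℕ) → Set₁
SpiesWin {n} G m r s = Σ (Pos n r → Pos n s → Set) λ W →
    (∀ R → Σ (Pos n s) λ S → W R S)
  × (∀ R S → W R S → ¬ UnguardedMeeting m R S)
  × (∀ R S → W R S → ∀ R' → Step G R R' →
       Σ (Pos n s) λ S' → Step G S S' × W R' S')

-- Root the tree at ρ.  For a position R of the revolutionaries let load R c be the number of
-- revolutionaries in the subtree of c, quota R c = ⌊load R c / m⌋, and
-- demand R u = quota R u − Σ quota R c over the children c of u.  The spies keep at least
-- demand R u of their number on every vertex u.  Since ⌊·/m⌋ is superadditive, the children's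
-- quotas add up to at most quota R u − ⌊k/m⌋ when k revolutionaries stand on u, so the demand is
-- positive wherever m revolutionaries meet; and the demands telescope to quota R ρ = ⌊r/m⌋ ≤ s,
-- so the spies can take up such a position.
--
-- In a round R → R′, a revolutionary lying, before or after its move, in the subtree of a child
-- of u lies in the subtree of u both before and after, and in the subtree of at most one child.
-- Hence Σ max (quota R c) (quota R′ c) over the children c of u is at most both quota R u and
-- quota R′ u.  The spies answer by sending quota R c − quota R′ c of them up from each child c to
-- its parent, or quota R′ c − quota R c down; the inequality says that every vertex u holds
-- enough spies for these departures, and the demands change exactly by arrivals minus departures.

module Submission where

open import Defs renaming (sym to Adj-sym)

open import Data.Empty using (⊥; ⊥-elim)
open import Data.Fin using (Fin; zero; suc; _≟_; fromℕ<)
import Data.Fin.Properties as Fin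
open import Data.List using (List; []; _∷_; _++_; length; filter; tabulate)
open import Data.List.Membership.Propositional using (_∈_; _∉_)
open import Data.List.Properties using (∷-injectiveˡ; ∷-injectiveʳ)
open import Data.List.Relation.Binary.Subset.Propositional using (_⊆_)
open import Data.List.Relation.Unary.All using ([]; _∷_)
open import Data.List.Relation.Unary.All.Properties using (¬Any⇒All¬; All¬⇒¬Any)
open import Data.List.Relation.Unary.AllPairs using ([]; _∷_)
open import Data.List.Relation.Unary.Any using (here; there)
open import Data.List.Relation.Unary.Linked using (Linked; [-]; _∷_)
open import Data.List.Relation.Unary.Unique.Propositional using (Unique)
open import Data.Nat using (ℕ; zero; suc; _≤_; _<_; z≤n; s≤s; _+_; _*_; _∸_; _⊔_; _⊓_; NonZero; _/_; _≤?_)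
open import Data.Nat.DivMod using (/-monoˡ-≤; m/n*n≤m; m*n/n≡m; n/n≡1)
open import Data.Nat.Induction using (<-wellFounded)
open import Data.Nat.Properties hiding (_≟_)
open import Algebra.Properties.Semiring.Sum +-*-semiring
  using (sum; sum-syntax; ∑-distrib-+; ∑-comm; sum-cong-≗; sum-replicate-zero; *-distribˡ-sum; *-distribʳ-sum)
open import Data.Nat.Tactic.RingSolver using (solve-∀)
open import Data.Product using (Σ; _×_; _,_; proj₁; proj₂)
open import Data.Sum using (_⊎_; inj₁; inj₂)
import Data.Sum as Sum
open import Data.Unit using (⊤; tt)
open import Data.Vec.Functional using (Vector) renaming (_∷_ to _◂_)
open import Function using (_∘_; id)
open import Induction.WellFounded using (Acc; acc; WellFounded)
import Relation.Binary.Construct.On as On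
open import Relation.Binary.PropositionalEquality
  using (_≡_; _≢_; refl; sym; trans; cong; cong₂; subst; module ≡-Reasoning)
open import Relation.Nullary using (¬_; Dec; yes; no)
open import Relation.Nullary.Decidable using (¬?; _×-dec_)
open import Relation.Unary using (Decidable)

𝟙 : ∀ {P : Set} → Dec P → ℕ
𝟙 (yes _) = 1
𝟙 (no _)  = 0

𝟙-yes : ∀ {P : Set} → P → (d : Dec P) → 𝟙 d ≡ 1
𝟙-yes p (yes _) = refl
𝟙-yes p (no ¬p) = ⊥-elim (¬p p)

𝟙-no : ∀ {P : Set} → ¬ P → (d : Dec P) → 𝟙 d ≡ 0
𝟙-no ¬p (yes p) = ⊥-elim (¬p p)
𝟙-no ¬p (no _)  = refl

𝟙-mono : ∀ {P Q : Set} → (P → Q) → (d : Dec P) (e : Dec Q) → 𝟙 d ≤ 𝟙 e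
𝟙-mono f (yes p) e = ≤-reflexive (sym (𝟙-yes (f p) e))
𝟙-mono f (no _)  e = z≤n

𝟙-cong : ∀ {P Q : Set} → (P → Q) → (Q → P) → (d : Dec P) (e : Dec Q) → 𝟙 d ≡ 𝟙 e
𝟙-cong f g d e = ≤-antisym (𝟙-mono f d e) (𝟙-mono g e d)

𝟙≤1 : ∀ {P : Set} (d : Dec P) → 𝟙 d ≤ 1
𝟙≤1 (yes _) = s≤s z≤n
𝟙≤1 (no _)  = z≤n

𝟙-sound : ∀ {P : Set} (d : Dec P) → 1 ≤ 𝟙 d → P
𝟙-sound (yes p) _ = p

𝟙+𝟙¬≡1 : ∀ {P : Set} (d : Dec P) → 𝟙 d + 𝟙 (¬? d) ≡ 1
𝟙+𝟙¬≡1 (yes _) = refl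
𝟙+𝟙¬≡1 (no _)  = refl

𝟙*-sound : ∀ {P : Set} (d : Dec P) x → 1 ≤ 𝟙 d * x → P
𝟙*-sound (yes p) x _ = p

∑-mono-≤ : ∀ {k} {f g : Vector ℕ k} → (∀ i → f i ≤ g i) → sum f ≤ sum g
∑-mono-≤ {zero}  f≤g = z≤n
∑-mono-≤ {suc k} f≤g = +-mono-≤ (f≤g zero) (∑-mono-≤ (f≤g ∘ suc))

∑-zero : ∀ {k} {f : Vector ℕ k} → (∀ i → f i ≡ 0) → sum f ≡ 0
∑-zero {k} f≡0 = trans (sum-cong-≗ f≡0) (sum-replicate-zero k)

∑-const : ∀ k x → ∑[ i < k ] x ≡ k * x
∑-const zero    x = refl
∑-const (suc k) x = cong (x +_) (∑-const k x)

∑-*ˡ : ∀ {k} x (f : Vector ℕ k) → ∑[ i < k ] (x * f i) ≡ x * sum f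
∑-*ˡ x f = sym (*-distribˡ-sum x f)

term≤∑ : ∀ {k} (f : Vector ℕ k) i → f i ≤ sum f
term≤∑ f zero    = m≤m+n (f zero) _
term≤∑ f (suc i) = ≤-trans (term≤∑ (f ∘ suc) i) (m≤n+m _ (f zero))

∑-pos : ∀ {k} (f : Vector ℕ k) → 1 ≤ sum f → Σ (Fin k) λ i → 1 ≤ f i
∑-pos {zero}  f ()
∑-pos {suc k} f 1≤∑ with 1 ≤? f zero
... | yes 1≤f₀ = zero , 1≤f₀
... | no 1≰f₀ with ∑-pos (f ∘ suc) (subst (λ t → 1 ≤ t + sum (f ∘ suc)) (n<1⇒n≡0 (≰⇒> 1≰f₀)) 1≤∑)
...   | i , 1≤fi = suc i , 1≤fi

∑-δ : ∀ {k} (x : Fin k) (h : Vector ℕ k) → ∑[ c < k ] (𝟙 (x ≟ c) * h c) ≡ h x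
∑-δ zero    h = trans (cong (1 * h zero +_) (∑-zero λ c → cong (_* h (suc c)) (𝟙-no (λ ()) (zero ≟ suc c))))
                      (trans (+-identityʳ _) (*-identityˡ (h zero)))
∑-δ (suc x) h = begin
  𝟙 (suc x ≟ zero) * h zero + ∑[ c < _ ] (𝟙 (suc x ≟ suc c) * h (suc c))
    ≡⟨ cong₂ _+_ (cong (_* h zero) (𝟙-no (λ ()) (suc x ≟ zero)))
                 (sum-cong-≗ λ c → cong (_* h (suc c))
                   (𝟙-cong Fin.suc-injective (cong suc) (suc x ≟ suc c) (x ≟ c))) ⟩
  ∑[ c < _ ] (𝟙 (x ≟ c) * h (suc c))
    ≡⟨ ∑-δ x (h ∘ suc) ⟩
  h (suc x) ∎
  where open ≡-Reasoning

∑-𝟙≟ : ∀ {k} (x : Fin k) → ∑[ c < k ] 𝟙 (x ≟ c) ≡ 1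
∑-𝟙≟ x = trans (sum-cong-≗ λ c → sym (*-identityʳ (𝟙 (x ≟ c)))) (∑-δ x λ _ → 1)

module _ (m : ℕ) .{{_ : NonZero m}} where

  /-superadditive : ∀ a b → a / m + b / m ≤ (a + b) / m
  /-superadditive a b = begin
    a / m + b / m               ≡⟨ m*n/n≡m (a / m + b / m) m ⟨
    (a / m + b / m) * m / m     ≤⟨ /-monoˡ-≤ m (begin
      (a / m + b / m) * m         ≡⟨ *-distribʳ-+ m (a / m) (b / m) ⟩
      a / m * m + b / m * m       ≤⟨ +-mono-≤ (m/n*n≤m a m) (m/n*n≤m b m) ⟩
      a + b                       ∎) ⟩
    (a + b) / m                 ∎
    where open ≤-Reasoning

  ∑-/ : ∀ {k} (h : Vector ℕ k) → ∑[ i < k ] (h i / m) ≤ sum h / m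
  ∑-/ {zero}  h = z≤n
  ∑-/ {suc k} h = ≤-trans (+-monoʳ-≤ (h zero / m) (∑-/ (h ∘ suc))) (/-superadditive (h zero) _)

  *-/-≤ : ∀ c x → c * (x / m) ≤ (c * x) / m
  *-/-≤ c x = begin
    c * (x / m)             ≡⟨ m*n/n≡m (c * (x / m)) m ⟨
    c * (x / m) * m / m     ≤⟨ /-monoˡ-≤ m (begin
      c * (x / m) * m         ≡⟨ *-assoc c (x / m) m ⟩
      c * (x / m * m)         ≤⟨ *-monoʳ-≤ c (m/n*n≤m x m) ⟩
      c * x                   ∎) ⟩
    (c * x) / m             ∎
    where open ≤-Reasoning

  ⊔-/ : ∀ a b → a / m ⊔ b / m ≤ (a ⊔ b) / m
  ⊔-/ a b = ⊔-lub (/-monoˡ-≤ m (m≤m⊔n a b)) (/-monoˡ-≤ m (m≤n⊔m a b))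

m+[n∸m]≡m⊔n : ∀ m n → m + (n ∸ m) ≡ m ⊔ n
m+[n∸m]≡m⊔n m n with ≤-total m n
... | inj₁ m≤n = trans (m+[n∸m]≡n m≤n) (sym (m≤n⇒m⊔n≡n m≤n))
... | inj₂ n≤m = trans (cong (m +_) (m≤n⇒m∸n≡0 n≤m)) (trans (+-identityʳ m) (sym (m≥n⇒m⊔n≡m n≤m)))

m+[n∸m]≡n+[m∸n] : ∀ m n → m + (n ∸ m) ≡ n + (m ∸ n)
m+[n∸m]≡n+[m∸n] m n = trans (m+[n∸m]≡m⊔n m n) (trans (⊔-comm m n) (sym (m+[n∸m]≡m⊔n n m)))

[m∸n]+o≤m : ∀ m n o → o ≤ m → o ≤ n → (m ∸ n) + o ≤ m
[m∸n]+o≤m m n o o≤m o≤n = begin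
  (m ∸ n) + o        ≤⟨ +-monoʳ-≤ (m ∸ n) (⊓-glb o≤n o≤m) ⟩
  (m ∸ n) + (n ⊓ m)  ≡⟨ +-comm (m ∸ n) (n ⊓ m) ⟩
  (n ⊓ m) + (m ∸ n)  ≡⟨ m⊓n+n∸m≡n n m ⟩
  m                  ∎
  where open ≤-Reasoning

transfer-balance : ∀ {g F f g′ F′ f′ d u D U} →
  g + F ≡ f → g′ + F′ ≡ f′ → f + d ≡ f′ + u → F + D ≡ F′ + U → g + (U + d) ≡ g′ + (u + D)
transfer-balance {g} {F} {f} {g′} {F′} {f′} {d} {u} {D} {U} g+F≡f g′+F′≡f′ f+d≡f′+u F+D≡F′+U =
  +-cancelʳ-≡ F _ _ (begin
    g + (U + d) + F        ≡⟨ regroup₁ g U d F ⟩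
    (g + F) + d + U        ≡⟨ cong (λ t → t + d + U) g+F≡f ⟩
    f + d + U              ≡⟨ cong (_+ U) f+d≡f′+u ⟩
    f′ + u + U             ≡⟨ cong (λ t → t + u + U) g′+F′≡f′ ⟨
    (g′ + F′) + u + U      ≡⟨ regroup₂ g′ F′ u U ⟩
    g′ + u + (F′ + U)      ≡⟨ cong (g′ + u +_) F+D≡F′+U ⟨
    g′ + u + (F + D)       ≡⟨ regroup₃ g′ u F D ⟩
    g′ + (u + D) + F       ∎)
  where
  open ≡-Reasoning
  regroup₁ : ∀ g U d F → g + (U + d) + F ≡ (g + F) + d + U
  regroup₁ = solve-∀
  regroup₂ : ∀ g′ F′ u U → (g′ + F′) + u + U ≡ g′ + u + (F′ + U)
  regroup₂ = solve-∀
  regroup₃ : ∀ g′ u F D → g′ + u + (F + D) ≡ g′ + (u + D) + F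
  regroup₃ = solve-∀

count : ∀ {k n} → Vector (Fin n) k → Fin n → ℕ
count {k} P v = ∑[ j < k ] 𝟙 (P j ≟ v)

count-pos : ∀ {k n} (P : Vector (Fin n) k) v → 1 ≤ count P v → Σ (Fin k) λ j → P j ≡ v
count-pos P v 1≤ with ∑-pos (λ j → 𝟙 (P j ≟ v)) 1≤
... | j , 1≤𝟙 = j , 𝟙-sound (P j ≟ v) 1≤𝟙

length-filter-tabulate : ∀ {A : Set} {P : A → Set} (P? : Decidable P) {k} (f : Fin k → A) →
  length (filter P? (tabulate f)) ≡ ∑[ i < k ] 𝟙 (P? (f i))
length-filter-tabulate P? {zero}  f = refl
length-filter-tabulate P? {suc k} f with P? (f zero)
... | yes _ = cong suc (length-filter-tabulate P? (f ∘ suc))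
... | no _  = length-filter-tabulate P? (f ∘ suc)

countAt≡count : ∀ {n r} (R : Pos n r) v → countAt R v ≡ count R v
countAt≡count R v = length-filter-tabulate (λ i → R i ≟ v) id

-- Moving tokens along prescribed moves

module Transport {n : ℕ} (_↝_ : Fin n → Fin n → Set) (↝-refl : ∀ {u} → u ↝ u) where

  Moves : Set
  Moves = Fin n → Fin n → ℕ

  outflow inflow : Moves → Fin n → ℕ
  outflow μ a = ∑[ b < n ] μ a b
  inflow  μ b = ∑[ a < n ] μ a b

  Admissible : Moves → Set
  Admissible μ = ∀ a b → 1 ≤ μ a b → a ↝ b

  Realisable : ∀ {s} → Vector (Fin n) s → Moves → Set
  Realisable {s} S μ = Σ (Vector (Fin n) s) λ S′ →
    (∀ j → S j ↝ S′ j) × (∀ v → count S′ v + outflow μ v ≡ count S v + inflow μ v)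

  unit : Fin n → Fin n → Moves
  unit u w a b = 𝟙 (u ≟ a) * 𝟙 (w ≟ b)

  unit≤ : ∀ {u w} (μ : Moves) → 1 ≤ μ u w → ∀ a b → unit u w a b ≤ μ a b
  unit≤ {u} {w} μ 1≤μuw a b with u ≟ a | w ≟ b
  ... | yes refl | yes refl = 1≤μuw
  ... | yes _    | no _     = z≤n
  ... | no _     | _        = z≤n

  outflow-unit : ∀ u w a → outflow (unit u w) a ≡ 𝟙 (u ≟ a)
  outflow-unit u w a =
    trans (∑-*ˡ (𝟙 (u ≟ a)) (λ b → 𝟙 (w ≟ b)))
      (trans (cong (𝟙 (u ≟ a) *_) (∑-𝟙≟ w)) (*-identityʳ _))

  inflow-unit : ∀ u w b → inflow (unit u w) b ≡ 𝟙 (w ≟ b)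
  inflow-unit u w b = ∑-δ u λ _ → 𝟙 (w ≟ b)

  realise-stay : ∀ {s} (S : Vector (Fin n) (suc s)) {μ} → Realisable (S ∘ suc) μ → Realisable S μ
  realise-stay S {μ} (S′ , moves , balance) =
    S zero ◂ S′ , (λ { zero → ↝-refl ; (suc j) → moves j }) , λ v →
      trans (+-assoc (𝟙 (S zero ≟ v)) _ _)
        (trans (cong (𝟙 (S zero ≟ v) +_) (balance v)) (sym (+-assoc (𝟙 (S zero ≟ v)) _ _)))

  realise-move : ∀ {s} (S : Vector (Fin n) (suc s)) {w μ μ⁻} → S zero ↝ w →
    (∀ a → outflow μ a ≡ outflow μ⁻ a + 𝟙 (S zero ≟ a)) →
    (∀ b → inflow μ b ≡ inflow μ⁻ b + 𝟙 (w ≟ b)) →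
    Realisable (S ∘ suc) μ⁻ → Realisable S μ
  realise-move S {w} {μ} {μ⁻} u↝w outflow≡ inflow≡ (S′ , moves , balance) =
    w ◂ S′ , (λ { zero → u↝w ; (suc j) → moves j }) , λ v → begin
      𝟙 (w ≟ v) + count S′ v + outflow μ v
        ≡⟨ cong (𝟙 (w ≟ v) + count S′ v +_) (outflow≡ v) ⟩
      𝟙 (w ≟ v) + count S′ v + (outflow μ⁻ v + 𝟙 (S zero ≟ v))
        ≡⟨ swap (𝟙 (w ≟ v)) (𝟙 (S zero ≟ v)) (count S′ v) (outflow μ⁻ v) ⟩
      𝟙 (S zero ≟ v) + (count S′ v + outflow μ⁻ v) + 𝟙 (w ≟ v)
        ≡⟨ cong (λ t → 𝟙 (S zero ≟ v) + t + 𝟙 (w ≟ v)) (balance v) ⟩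
      𝟙 (S zero ≟ v) + (count (S ∘ suc) v + inflow μ⁻ v) + 𝟙 (w ≟ v)
        ≡⟨ regroup (𝟙 (S zero ≟ v)) (count (S ∘ suc) v) (inflow μ⁻ v) (𝟙 (w ≟ v)) ⟩
      𝟙 (S zero ≟ v) + count (S ∘ suc) v + (inflow μ⁻ v + 𝟙 (w ≟ v))
        ≡⟨ cong (count S v +_) (inflow≡ v) ⟨
      count S v + inflow μ v ∎
    where
    open ≡-Reasoning
    swap : ∀ a b c o → a + c + (o + b) ≡ b + (c + o) + a
    swap = solve-∀
    regroup : ∀ b c i a → b + (c + i) + a ≡ b + c + (i + a)
    regroup = solve-∀

  -- The tokens are served in turn: each performs one of the moves still pending at its vertex, if any.
  transport : ∀ {s} (S : Vector (Fin n) s) (μ : Moves) → Admissible μ →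
    (∀ u → outflow μ u ≤ count S u) → Realisable S μ
  transport {zero} S μ adm outflow≤ = S , (λ ()) , λ v →
    trans (n≤0⇒n≡0 (outflow≤ v))
      (sym (∑-zero λ a → n≤0⇒n≡0 (≤-trans (term≤∑ (μ a) v) (outflow≤ a))))
  transport {suc s} S μ adm outflow≤ with 1 ≤? outflow μ (S zero)
  ... | no 1≰outflow = realise-stay S (transport (S ∘ suc) μ adm outflow≤′)
    where
    outflow≤′ : ∀ u → outflow μ u ≤ count (S ∘ suc) u
    outflow≤′ u with S zero ≟ u | outflow≤ u
    ... | yes refl | _ = ≤-trans (≤-reflexive (n<1⇒n≡0 (≰⇒> 1≰outflow))) z≤n
    ... | no _     | ≤count = ≤count
  ... | yes 1≤outflow with ∑-pos (μ (S zero)) 1≤outflow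
  ...   | w , 1≤μuw =
    realise-move S (adm _ _ 1≤μuw) outflow≡ inflow≡ (transport (S ∘ suc) μ⁻ μ⁻-admissible outflow≤′)
    where
    μ⁻ : Moves
    μ⁻ a b = μ a b ∸ unit (S zero) w a b
    μ⁻-admissible : Admissible μ⁻
    μ⁻-admissible a b 1≤μ⁻ = adm a b (≤-trans 1≤μ⁻ (m∸n≤m (μ a b) (unit (S zero) w a b)))
    split : ∀ a b → μ a b ≡ μ⁻ a b + unit (S zero) w a b
    split a b = sym (m∸n+n≡m (unit≤ μ 1≤μuw a b))
    outflow≡ : ∀ a → outflow μ a ≡ outflow μ⁻ a + 𝟙 (S zero ≟ a)
    outflow≡ a = trans (sum-cong-≗ (split a))
      (trans (∑-distrib-+ (μ⁻ a) (unit (S zero) w a)) (cong (outflow μ⁻ a +_) (outflow-unit (S zero) w a)))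
    inflow≡ : ∀ b → inflow μ b ≡ inflow μ⁻ b + 𝟙 (w ≟ b)
    inflow≡ b = trans (sum-cong-≗ (λ a → split a b))
      (trans (∑-distrib-+ (λ a → μ⁻ a b) (λ a → unit (S zero) w a b))
        (cong (inflow μ⁻ b +_) (inflow-unit (S zero) w b)))
    outflow≤′ : ∀ u → outflow μ⁻ u ≤ count (S ∘ suc) u
    outflow≤′ u = +-cancelʳ-≤ (𝟙 (S zero ≟ u)) _ _
      (≤-trans (≤-reflexive (sym (outflow≡ u)))
        (≤-trans (outflow≤ u) (≤-reflexive (+-comm (𝟙 (S zero ≟ u)) _))))

module _ {n : ℕ} (u₀ : Fin n) (h : Vector ℕ n) where
  open Transport {n} (λ _ _ → ⊤) tt

  private
    μ : Moves
    μ a b = 𝟙 (u₀ ≟ a) * h b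

    outflow-μ : ∀ a → outflow μ a ≡ 𝟙 (u₀ ≟ a) * sum h
    outflow-μ a = ∑-*ˡ (𝟙 (u₀ ≟ a)) h

    inflow-μ : ∀ b → inflow μ b ≡ h b
    inflow-μ b = ∑-δ u₀ λ _ → h b

  -- Start with all s tokens on u₀ and send h b of them to each b.
  place : ∀ {s} → sum h ≤ s → Σ (Vector (Fin n) s) λ S → ∀ v → h v ≤ count S v
  place {s} ∑h≤s = S , λ v → +-cancelʳ-≤ (𝟙 (u₀ ≟ v) * sum h) (h v) (count S v) (begin
    h v + 𝟙 (u₀ ≟ v) * sum h     ≤⟨ +-monoʳ-≤ (h v) (*-monoʳ-≤ (𝟙 (u₀ ≟ v)) ∑h≤s) ⟩
    h v + 𝟙 (u₀ ≟ v) * s         ≡⟨ +-comm (h v) _ ⟩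
    𝟙 (u₀ ≟ v) * s + h v         ≡⟨ cong₂ _+_ (sym (count-heap v)) (sym (inflow-μ v)) ⟩
    count heap v + inflow μ v    ≡⟨ balance v ⟨
    count S v + outflow μ v      ≡⟨ cong (count S v +_) (outflow-μ v) ⟩
    count S v + 𝟙 (u₀ ≟ v) * sum h ∎)
    where
    open ≤-Reasoning
    heap : Vector (Fin n) s
    heap _ = u₀
    count-heap : ∀ a → count heap a ≡ 𝟙 (u₀ ≟ a) * s
    count-heap a = trans (∑-const s (𝟙 (u₀ ≟ a))) (*-comm s _)
    realised : Realisable heap μ
    realised = transport heap μ (λ _ _ _ → tt) λ a → begin
      outflow μ a            ≡⟨ outflow-μ a ⟩
      𝟙 (u₀ ≟ a) * sum h     ≤⟨ *-monoʳ-≤ (𝟙 (u₀ ≟ a)) ∑h≤s ⟩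
      𝟙 (u₀ ≟ a) * s         ≡⟨ count-heap a ⟨
      count heap a           ∎
    S : Vector (Fin n) s
    S = proj₁ realised
    balance : ∀ v → count S v + outflow μ v ≡ count heap v + inflow μ v
    balance = proj₂ (proj₂ realised)

-- Walks and rooted trees

module Walks {n : ℕ} (G : Graph n) where
  open import Data.List.Membership.DecPropositional (_≟_ {n}) using (_∈?_)

  verts : ∀ {u v} → Walk G u v → List (Fin n)
  verts {u} here       = u ∷ []
  verts {u} (step _ p) = u ∷ verts p

  len : ∀ {u v} → Walk G u v → ℕ
  len here       = 0
  len (step _ p) = suc (len p)

  next : ∀ {u v} → Walk G u v → Fin n
  next {u} here          = u
  next (step {w = w} _ _) = w

  Simple : ∀ {u v} → Walk G u v → Set
  Simple p = Unique (verts p)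

  length-verts : ∀ {u v} (p : Walk G u v) → length (verts p) ≡ suc (len p)
  length-verts here       = refl
  length-verts (step _ p) = cong suc (length-verts p)

  head-cong : ∀ {u v u′ v′} (p : Walk G u v) (q : Walk G u′ v′) → verts p ≡ verts q → u ≡ u′
  head-cong here       here       eq = ∷-injectiveˡ eq
  head-cong here       (step _ _) eq = ∷-injectiveˡ eq
  head-cong (step _ _) here       eq = ∷-injectiveˡ eq
  head-cong (step _ _) (step _ _) eq = ∷-injectiveˡ eq

  next-cong : ∀ {u v} (p q : Walk G u v) → verts p ≡ verts q → next p ≡ next q
  next-cong here       here       eq = refl
  next-cong here       (step e q) eq =
    ⊥-elim (0≢1+n (suc-injective (trans (cong length eq) (length-verts (step e q)))))
  next-cong (step e p) here       eq =
    ⊥-elim (0≢1+n (suc-injective (trans (cong length (sym eq)) (length-verts (step e p)))))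
  next-cong (step _ p) (step _ q) eq = head-cong p q (∷-injectiveʳ eq)

  last∈ : ∀ {u v} (p : Walk G u v) → v ∈ verts p
  last∈ here       = here refl
  last∈ (step _ p) = there (last∈ p)

  head∈ : ∀ {u v} (p : Walk G u v) → u ∈ verts p
  head∈ here       = here refl
  head∈ (step _ _) = here refl

  _◅◅_ : ∀ {u v w} → Walk G u v → Walk G v w → Walk G u w
  here       ◅◅ q = q
  (step e p) ◅◅ q = step e (p ◅◅ q)

  ∈-◅◅⁻ : ∀ {u v w z} (p : Walk G u v) (q : Walk G v w) →
    z ∈ verts (p ◅◅ q) → z ∈ verts p ⊎ z ∈ verts q
  ∈-◅◅⁻ here       q z∈         = inj₂ z∈
  ∈-◅◅⁻ (step e p) q (here refl) = inj₁ (here refl)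
  ∈-◅◅⁻ (step e p) q (there z∈)  = Sum.map₁ there (∈-◅◅⁻ p q z∈)

  reverse : ∀ {u v} → Walk G u v → Walk G v u
  reverse here       = here
  reverse (step e p) = reverse p ◅◅ step (Adj-sym G e) here

  ∈-reverse⁻ : ∀ {u v z} (p : Walk G u v) → z ∈ verts (reverse p) → z ∈ verts p
  ∈-reverse⁻ here z∈ = z∈
  ∈-reverse⁻ (step e p) z∈ with ∈-◅◅⁻ (reverse p) (step (Adj-sym G e) here) z∈
  ... | inj₁ z∈p                 = there (∈-reverse⁻ p z∈p)
  ... | inj₂ (here refl)         = there (head∈ p)
  ... | inj₂ (there (here refl)) = here refl

  linked-snoc : ∀ {u v a} (p : Walk G u v) → Adj G v a → Linked (Adj G) (verts p ++ a ∷ [])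
  linked-snoc here                va = va ∷ [-]
  linked-snoc (step e here)       va = e ∷ va ∷ [-]
  linked-snoc (step e (step f p)) va = e ∷ linked-snoc (step f p) va

  takeUntil : ∀ {u v x} (p : Walk G u v) → x ∈ verts p → Σ (Walk G u x) λ q → verts q ⊆ verts p
  takeUntil here       (here refl) = here , id
  takeUntil (step e p) (here refl) = here , λ { (here refl) → here refl }
  takeUntil (step e p) (there x∈) with takeUntil p x∈
  ... | q , q⊆p = step e q , λ { (here refl) → here refl ; (there z∈) → there (q⊆p z∈) }

  dropUntil : ∀ {u w v} (p : Walk G w v) → u ∈ verts p →
    Σ (Walk G u v) λ q → verts q ⊆ verts p × (Simple p → Simple q)
  dropUntil here       (here refl) = here , id , id
  dropUntil (step e p) (here refl) = step e p , id , id
  dropUntil (step e p) (there u∈) with dropUntil p u∈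
  ... | q , q⊆p , simple = q , there ∘ q⊆p , λ { (_ ∷ p-simple) → simple p-simple }

  shorten : ∀ {u v} (p : Walk G u v) → Σ (Walk G u v) λ q → Simple q × verts q ⊆ verts p
  shorten here = here , [] ∷ [] , id
  shorten {u} (step e p) with shorten p
  ... | q , q-simple , q⊆p with u ∈? verts q
  ...   | yes u∈q = let q′ , q′⊆q , simple = dropUntil q u∈q in q′ , simple q-simple , there ∘ q⊆p ∘ q′⊆q
  ...   | no u∉q  = step e q , ¬Any⇒All¬ _ u∉q ∷ q-simple ,
                    λ { (here refl) → here refl ; (there z∈) → there (q⊆p z∈) }

  apex-cycle : ∀ {x y a} (p : Walk G x y) → Simple p → a ∉ verts p →
    Adj G a x → Adj G y a → x ≢ y → HasCycle G
  apex-cycle here _ _ _ _ x≢x = ⊥-elim (x≢x refl)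
  apex-cycle {a = a} (step e p) p-simple a∉p ax ya _ =
    a , verts (step e p) , two≤ , ¬Any⇒All¬ _ a∉p ∷ p-simple , ax ∷ linked-snoc (step e p) ya
    where
    two≤ : 2 ≤ length (verts (step e p))
    two≤ = subst (2 ≤_) (sym (length-verts (step e p))) (s≤s (s≤s z≤n))

  module _ (acyclic : ¬ HasCycle G) where

    -- Different second vertices x ≠ y would give a walk from x to y avoiding u, which shortens
    -- to a simple path closing a cycle through u.
    simple-unique : ∀ {u v} (p q : Walk G u v) → Simple p → Simple q → verts p ≡ verts q
    simple-unique here       here       _ _         = refl
    simple-unique here       (step _ q) _ (u∉q ∷ _) = ⊥-elim (All¬⇒¬Any u∉q (last∈ q))
    simple-unique (step _ p) here       (u∉p ∷ _) _ = ⊥-elim (All¬⇒¬Any u∉p (last∈ p))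
    simple-unique (step {w = x} ux p) (step {w = y} uy q) (u∉p ∷ p-simple) (u∉q ∷ q-simple) with x ≟ y
    ... | yes refl = cong (_ ∷_) (simple-unique p q p-simple q-simple)
    ... | no x≢y with shorten (p ◅◅ reverse q)
    ...   | r , r-simple , r⊆ = ⊥-elim (acyclic (apex-cycle r r-simple u∉r ux (Adj-sym G uy) x≢y))
      where
      u∉r : _ ∉ verts r
      u∉r u∈r with ∈-◅◅⁻ p (reverse q) (r⊆ u∈r)
      ... | inj₁ u∈p = All¬⇒¬Any u∉p u∈p
      ... | inj₂ u∈q = All¬⇒¬Any u∉q (∈-reverse⁻ q u∈q)

    simple-unique-len : ∀ {u v} (p q : Walk G u v) → Simple p → Simple q → len p ≡ len q
    simple-unique-len p q p-simple q-simple =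
      suc-injective (trans (sym (length-verts p))
        (trans (cong length (simple-unique p q p-simple q-simple)) (length-verts q)))

    simple-unique-next : ∀ {u v} (p q : Walk G u v) → Simple p → Simple q → next p ≡ next q
    simple-unique-next p q p-simple q-simple = next-cong p q (simple-unique p q p-simple q-simple)

    adjacent-next : ∀ {x y v} (p : Walk G y v) → Simple p → Adj G x y → x ∈ verts p → next p ≡ x
    adjacent-next here       _ xy (here refl) = ⊥-elim (irrefl G xy)
    adjacent-next (step e p) _ xy (here refl) = ⊥-elim (irrefl G xy)
    adjacent-next {x} (step {w = w} e p) (y∉p ∷ _) xy (there x∈p) with w ≟ x
    ... | yes w≡x = w≡x
    ... | no w≢x with takeUntil p x∈p
    ...   | prefix , prefix⊆p with shorten prefix
    ...     | q , q-simple , q⊆prefix =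
      ⊥-elim (acyclic (apex-cycle q q-simple (All¬⇒¬Any y∉p ∘ prefix⊆p ∘ q⊆prefix) e xy w≢x))

record RootedTree {n : ℕ} (G : Graph n) : Set where
  field
    root            : Fin n
    parent          : Fin n → Fin n
    depth           : Fin n → ℕ
    parent-adjacent : ∀ {v} → v ≢ root → Adj G v (parent v)
    depth-parent    : ∀ {v} → v ≢ root → depth v ≡ suc (depth (parent v))
    edge-parent     : ∀ {x y} → Adj G x y → (x ≢ root × parent x ≡ y) ⊎ (y ≢ root × parent y ≡ x)

module _ {n : ℕ} {G : Graph n} where
  open Walks G
  open import Data.List.Membership.DecPropositional (_≟_ {n}) using (_∈?_)

  -- Every vertex is joined to the root by a unique simple path; the parent is the next vertex on it.
  rootAt : Connected G → ¬ HasCycle G → Fin n → RootedTree G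
  rootAt connected acyclic ρ = record
    { root            = ρ
    ; parent          = next ∘ path
    ; depth           = len ∘ path
    ; parent-adjacent = λ {v} v≢ρ → proj₁ (first-step (path v) (path-simple v) v≢ρ)
    ; depth-parent    = λ {v} v≢ρ → proj₂ (first-step (path v) (path-simple v) v≢ρ)
    ; edge-parent     = edge-parent
    }
    where
    path : ∀ v → Walk G v ρ
    path v = proj₁ (shorten (connected v ρ))

    path-simple : ∀ v → Simple (path v)
    path-simple v = proj₁ (proj₂ (shorten (connected v ρ)))

    first-step : ∀ {v} (p : Walk G v ρ) → Simple p → v ≢ ρ →
      Adj G v (next p) × len p ≡ suc (len (path (next p)))
    first-step here       _                 v≢ρ = ⊥-elim (v≢ρ refl)
    first-step (step e p) (_ ∷ p-simple) _   =
      e , cong suc (simple-unique-len acyclic p (path _) p-simple (path-simple _))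

    edge-parent : ∀ {x y} → Adj G x y → (x ≢ ρ × next (path x) ≡ y) ⊎ (y ≢ ρ × next (path y) ≡ x)
    edge-parent {x} {y} xy with x ∈? verts (path y)
    ... | no x∉ = inj₁ ((λ { refl → x∉ (last∈ (path y)) }) ,
                        simple-unique-next acyclic (path x) (step xy (path y))
                          (path-simple x) (¬Any⇒All¬ _ x∉ ∷ path-simple y))
    ... | yes x∈ = inj₂ (y≢ρ , adjacent-next acyclic (path y) (path-simple y) xy x∈)
      where
      y≢ρ : y ≢ ρ
      y≢ρ refl with subst (x ∈_) (simple-unique acyclic (path ρ) here (path-simple ρ) ([] ∷ [])) x∈
      ... | here refl = irrefl G xy

  tree⇒rooted : IsTree G → RootedTree G
  tree⇒rooted (1≤n , connected , acyclic) = rootAt connected acyclic (fromℕ< 1≤n)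

-- Subtrees of a rooted tree

module Subtrees {n : ℕ} {G : Graph n} (T : RootedTree G) where
  open RootedTree T

  infix 4 _⪯_ _⪯?_

  -- x ⪯ c : x lies in the subtree rooted at c
  data _⪯_ : Fin n → Fin n → Set where
    ⪯-refl   : ∀ {c} → c ⪯ c
    ⪯-parent : ∀ {x c} → x ≢ root → parent x ⪯ c → x ⪯ c

  _≺_ : Fin n → Fin n → Set
  x ≺ y = depth x < depth y

  parent≺ : ∀ {x} → x ≢ root → parent x ≺ x
  parent≺ x≢ρ = ≤-reflexive (sym (depth-parent x≢ρ))

  ≺-wellFounded : WellFounded _≺_
  ≺-wellFounded = On.wellFounded depth <-wellFounded

  ⪯-depth : ∀ {x c} → x ⪯ c → depth c ≤ depth x
  ⪯-depth ⪯-refl             = ≤-refl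
  ⪯-depth (⪯-parent x≢ρ x⪯c) = ≤-trans (⪯-depth x⪯c) (<⇒≤ (parent≺ x≢ρ))

  parent⋠ : ∀ {c} → c ≢ root → ¬ (parent c ⪯ c)
  parent⋠ c≢ρ p⪯c = <⇒≱ (parent≺ c≢ρ) (⪯-depth p⪯c)

  root⪯ : ∀ {c} → root ⪯ c → c ≡ root
  root⪯ ⪯-refl           = refl
  root⪯ (⪯-parent ρ≢ρ _) = ⊥-elim (ρ≢ρ refl)

  ⪯-root : ∀ x → x ⪯ root
  ⪯-root x = go x (≺-wellFounded x)
    where
    go : ∀ x → Acc _≺_ x → x ⪯ root
    go x (acc rs) with x ≟ root
    ... | yes refl = ⪯-refl
    ... | no x≢ρ   = ⪯-parent x≢ρ (go (parent x) (rs (parent≺ x≢ρ)))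

  _⪯?_ : ∀ x c → Dec (x ⪯ c)
  x ⪯? c = go x (≺-wellFounded x)
    where
    go : ∀ x → Acc _≺_ x → Dec (x ⪯ c)
    go x (acc rs) with x ≟ c | x ≟ root
    ... | yes refl | _        = yes ⪯-refl
    ... | no x≢c   | yes refl = no λ { ⪯-refl → x≢c refl ; (⪯-parent ρ≢ρ _) → ρ≢ρ refl }
    ... | no x≢c   | no x≢ρ with go (parent x) (rs (parent≺ x≢ρ))
    ...   | yes p⪯c = yes (⪯-parent x≢ρ p⪯c)
    ...   | no p⋠c  = no λ { ⪯-refl → x≢c refl ; (⪯-parent _ p⪯c) → p⋠c p⪯c }

  ⪯-unfold : ∀ {x} c → x ≢ root → 𝟙 (x ⪯? c) ≡ 𝟙 (x ≟ c) + 𝟙 (parent x ⪯? c)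
  ⪯-unfold {x} c x≢ρ = by-cases (x ≟ c)
    where
    by-cases : (x≟c : Dec (x ≡ c)) → 𝟙 (x ⪯? c) ≡ 𝟙 x≟c + 𝟙 (parent x ⪯? c)
    by-cases (yes refl) = trans (𝟙-yes ⪯-refl (x ⪯? x)) (cong suc (sym (𝟙-no (parent⋠ x≢ρ) (parent x ⪯? x))))
    by-cases (no x≢c)   = 𝟙-cong (λ { ⪯-refl → ⊥-elim (x≢c refl) ; (⪯-parent _ p⪯c) → p⪯c })
                                 (⪯-parent x≢ρ) (x ⪯? c) (parent x ⪯? c)

  Child : Fin n → Fin n → Set
  Child u c = c ≢ root × parent c ≡ u

  child? : ∀ u c → Dec (Child u c)
  child? u c = ¬? (c ≟ root) ×-dec (parent c ≟ u)

  childSum : Fin n → (Fin n → ℕ) → ℕ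
  childSum u h = ∑[ c < n ] (𝟙 (child? u c) * h c)

  nonRoot : Fin n → ℕ
  nonRoot c = 𝟙 (¬? (root ≟ c))

  childSum-+ : ∀ u f g → childSum u (λ c → f c + g c) ≡ childSum u f + childSum u g
  childSum-+ u f g = trans (sum-cong-≗ λ c → *-distribˡ-+ (𝟙 (child? u c)) (f c) (g c))
                           (∑-distrib-+ (λ c → 𝟙 (child? u c) * f c) (λ c → 𝟙 (child? u c) * g c))

  childSum-mono : ∀ u {f g} → (∀ c → f c ≤ g c) → childSum u f ≤ childSum u g
  childSum-mono u f≤g = ∑-mono-≤ λ c → *-monoʳ-≤ (𝟙 (child? u c)) (f≤g c)

  childSum-zero : ∀ u {f} → (∀ c → Child u c → f c ≡ 0) → childSum u f ≡ 0
  childSum-zero u {f} f≡0 = ∑-zero term≡0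
    where
    term≡0 : ∀ c → 𝟙 (child? u c) * f c ≡ 0
    term≡0 c with child? u c
    ... | yes child = trans (*-identityˡ (f c)) (f≡0 c child)
    ... | no _      = refl

  childSum-δ : ∀ u x → childSum u (λ c → 𝟙 (x ≟ c)) ≡ 𝟙 (child? u x)
  childSum-δ u x =
    trans (sum-cong-≗ λ c → *-comm (𝟙 (child? u c)) (𝟙 (x ≟ c))) (∑-δ x (λ c → 𝟙 (child? u c)))

  ∑-child? : ∀ c → ∑[ u < n ] 𝟙 (child? u c) ≡ nonRoot c
  ∑-child? c with root ≟ c
  ... | yes refl = ∑-zero λ u → 𝟙-no (λ child → proj₁ child refl) (child? u root)
  ... | no ρ≢c   =
    trans (sum-cong-≗ λ u → 𝟙-cong proj₂ (ρ≢c ∘ sym ,_) (child? u c) (parent c ≟ u)) (∑-𝟙≟ (parent c))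

  ∑-parent : ∀ c x → ∑[ u < n ] (𝟙 (child? u c) * x) ≡ nonRoot c * x
  ∑-parent c x = trans (sym (*-distribʳ-sum x (λ u → 𝟙 (child? u c)))) (cong (_* x) (∑-child? c))

  childSum-⪯-step : ∀ {x} u → x ≢ root →
    𝟙 (parent x ⪯? u) ≡ 𝟙 (parent x ≟ u) + childSum u (λ c → 𝟙 (parent x ⪯? c)) →
    childSum u (λ c → 𝟙 (x ⪯? c)) ≡ 𝟙 (parent x ⪯? u)
  childSum-⪯-step {x} u x≢ρ split-parent = begin
    childSum u (λ c → 𝟙 (x ⪯? c))
      ≡⟨ sum-cong-≗ (λ c → cong (𝟙 (child? u c) *_) (⪯-unfold c x≢ρ)) ⟩
    childSum u (λ c → 𝟙 (x ≟ c) + 𝟙 (parent x ⪯? c))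
      ≡⟨ childSum-+ u (λ c → 𝟙 (x ≟ c)) (λ c → 𝟙 (parent x ⪯? c)) ⟩
    childSum u (λ c → 𝟙 (x ≟ c)) + childSum u (λ c → 𝟙 (parent x ⪯? c))
      ≡⟨ cong (_+ childSum u (λ c → 𝟙 (parent x ⪯? c)))
              (trans (childSum-δ u x) (𝟙-cong proj₂ (x≢ρ ,_) (child? u x) (parent x ≟ u))) ⟩
    𝟙 (parent x ≟ u) + childSum u (λ c → 𝟙 (parent x ⪯? c))
      ≡⟨ split-parent ⟨
    𝟙 (parent x ⪯? u) ∎
    where open ≡-Reasoning

  ⪯-split : ∀ x u → 𝟙 (x ⪯? u) ≡ 𝟙 (x ≟ u) + childSum u (λ c → 𝟙 (x ⪯? c))
  ⪯-split x u = go x (≺-wellFounded x)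
    where
    go : ∀ x → Acc _≺_ x → 𝟙 (x ⪯? u) ≡ 𝟙 (x ≟ u) + childSum u (λ c → 𝟙 (x ⪯? c))
    go x (acc rs) = by-cases (x ≟ root)
      where
      by-cases : Dec (x ≡ root) → 𝟙 (x ⪯? u) ≡ 𝟙 (x ≟ u) + childSum u (λ c → 𝟙 (x ⪯? c))
      by-cases (yes refl) = sym (trans
        (cong (𝟙 (root ≟ u) +_) (childSum-zero u λ c child → 𝟙-no (proj₁ child ∘ root⪯) (root ⪯? c)))
        (trans (+-identityʳ _) (𝟙-cong (λ { refl → ⪯-refl }) (sym ∘ root⪯) (root ≟ u) (root ⪯? u))))
      by-cases (no x≢ρ) = trans (⪯-unfold u x≢ρ)
        (cong (𝟙 (x ≟ u) +_) (sym (childSum-⪯-step u x≢ρ (go (parent x) (rs (parent≺ x≢ρ))))))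

  childSum-⪯ : ∀ {x} u → x ≢ root → childSum u (λ c → 𝟙 (x ⪯? c)) ≡ 𝟙 (parent x ⪯? u)
  childSum-⪯ {x} u x≢ρ = childSum-⪯-step u x≢ρ (⪯-split (parent x) u)

  childSum-⪯-≤ : ∀ x u → childSum u (λ c → 𝟙 (x ⪯? c)) ≤ 𝟙 (x ⪯? u)
  childSum-⪯-≤ x u = ≤-trans (m≤n+m _ (𝟙 (x ≟ u))) (≤-reflexive (sym (⪯-split x u)))

  ∑-telescope : ∀ h → sum h ≡ h root + ∑[ u < n ] childSum u h
  ∑-telescope h = begin
    sum h
      ≡⟨ sum-cong-≗ (λ c → trans (sym (*-identityˡ (h c))) (cong (_* h c) (sym (𝟙+𝟙¬≡1 (root ≟ c))))) ⟩
    ∑[ c < n ] ((𝟙 (root ≟ c) + nonRoot c) * h c)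
      ≡⟨ sum-cong-≗ (λ c → *-distribʳ-+ (h c) (𝟙 (root ≟ c)) (nonRoot c)) ⟩
    ∑[ c < n ] (𝟙 (root ≟ c) * h c + nonRoot c * h c)
      ≡⟨ ∑-distrib-+ (λ c → 𝟙 (root ≟ c) * h c) (λ c → nonRoot c * h c) ⟩
    ∑[ c < n ] (𝟙 (root ≟ c) * h c) + ∑[ c < n ] (nonRoot c * h c)
      ≡⟨ cong₂ _+_ (∑-δ root h) (sum-cong-≗ λ c → cong (_* h c) (sym (∑-child? c))) ⟩
    h root + ∑[ c < n ] (∑[ u < n ] 𝟙 (child? u c) * h c)
      ≡⟨ cong (h root +_) (sum-cong-≗ λ c → *-distribʳ-sum (h c) (λ u → 𝟙 (child? u c))) ⟩
    h root + ∑[ c < n ] ∑[ u < n ] (𝟙 (child? u c) * h c)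
      ≡⟨ cong (h root +_) (∑-comm (λ c u → 𝟙 (child? u c) * h c)) ⟩
    h root + ∑[ u < n ] childSum u h ∎
    where open ≡-Reasoning

  childSum-∑ : ∀ {k} u (f : Fin k → Fin n → ℕ) →
    childSum u (λ c → ∑[ i < k ] f i c) ≡ ∑[ i < k ] childSum u (f i)
  childSum-∑ {k} u f = trans (sum-cong-≗ λ c → sym (∑-*ˡ (𝟙 (child? u c)) (λ i → f i c)))
                             (∑-comm (λ c i → 𝟙 (child? u c) * f i c))

  childSum-⪯-⊔ : ∀ {x x′} u → x′ ≡ x ⊎ Adj G x x′ →
    childSum u (λ c → 𝟙 (x ⪯? c) ⊔ 𝟙 (x′ ⪯? c)) ≤ 𝟙 (x ⪯? u)
  childSum-⪯-⊔ {x} u (inj₁ refl) =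
    ≤-trans (≤-reflexive (sum-cong-≗ λ c → cong (𝟙 (child? u c) *_) (⊔-idem _))) (childSum-⪯-≤ x u)
  childSum-⪯-⊔ {x} {x′} u (inj₂ xx′) with edge-parent xx′
  ... | inj₁ (x≢ρ , px≡x′) = ≤-trans
          (childSum-mono u λ c → ⊔-lub ≤-refl
            (𝟙-mono (⪯-parent x≢ρ ∘ subst (_⪯ c) (sym px≡x′)) (x′ ⪯? c) (x ⪯? c)))
          (childSum-⪯-≤ x u)
  ... | inj₂ (x′≢ρ , px′≡x) = ≤-trans
          (childSum-mono u λ c → ⊔-lub
            (𝟙-mono (⪯-parent x′≢ρ ∘ subst (_⪯ c) (sym px′≡x)) (x ⪯? c) (x′ ⪯? c)) ≤-refl)
          (≤-reflexive (trans (childSum-⪯ u x′≢ρ) (cong (λ y → 𝟙 (y ⪯? u)) px′≡x)))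

-- The spies' strategy

Step-sym : ∀ {n k} (G : Graph n) {p p′ : Pos n k} → Step G p p′ → Step G p′ p
Step-sym G moved i = Sum.map sym (Adj-sym G) (moved i)

module Strategy {n : ℕ} {G : Graph n} (T : RootedTree G) (m : ℕ) .{{_ : NonZero m}} {r : ℕ} where
  open RootedTree T
  open Subtrees T

  load : Pos n r → Fin n → ℕ
  load R c = ∑[ i < r ] 𝟙 (R i ⪯? c)

  quota : Pos n r → Fin n → ℕ
  quota R c = load R c / m

  demand : Pos n r → Fin n → ℕ
  demand R u = quota R u ∸ childSum u (quota R)

  Guarded : ∀ {s} → Pos n r → Pos n s → Set
  Guarded R S = ∀ v → demand R v ≤ count S v

  load-root : ∀ R → load R root ≡ r
  load-root R =
    trans (sum-cong-≗ λ i → 𝟙-yes (⪯-root (R i)) (R i ⪯? root)) (trans (∑-const r 1) (*-identityʳ r))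

  load-split : ∀ R u → load R u ≡ count R u + childSum u (load R)
  load-split R u = begin
    load R u
      ≡⟨ sum-cong-≗ (λ i → ⪯-split (R i) u) ⟩
    ∑[ i < r ] (𝟙 (R i ≟ u) + childSum u (λ c → 𝟙 (R i ⪯? c)))
      ≡⟨ ∑-distrib-+ (λ i → 𝟙 (R i ≟ u)) (λ i → childSum u (λ c → 𝟙 (R i ⪯? c))) ⟩
    count R u + ∑[ i < r ] childSum u (λ c → 𝟙 (R i ⪯? c))
      ≡⟨ cong (count R u +_) (childSum-∑ u (λ i c → 𝟙 (R i ⪯? c))) ⟨
    count R u + childSum u (load R) ∎
    where open ≡-Reasoning

  childSum-/ : ∀ u h → childSum u (λ c → h c / m) ≤ childSum u h / m
  childSum-/ u h =
    ≤-trans (∑-mono-≤ λ c → *-/-≤ m (𝟙 (child? u c)) (h c)) (∑-/ m (λ c → 𝟙 (child? u c) * h c))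

  quota-split : ∀ R u → count R u / m + childSum u (quota R) ≤ quota R u
  quota-split R u = begin
    count R u / m + childSum u (quota R)        ≤⟨ +-monoʳ-≤ (count R u / m) (childSum-/ u (load R)) ⟩
    count R u / m + childSum u (load R) / m     ≤⟨ /-superadditive m (count R u) _ ⟩
    (count R u + childSum u (load R)) / m       ≡⟨ cong (_/ m) (load-split R u) ⟨
    quota R u                                   ∎
    where open ≤-Reasoning

  demand+childSum : ∀ R u → demand R u + childSum u (quota R) ≡ quota R u
  demand+childSum R u = m∸n+n≡m (m+n≤o⇒n≤o (count R u / m) (quota-split R u))

  meeting⇒demand : ∀ R u → m ≤ count R u → 1 ≤ demand R u
  meeting⇒demand R u m≤count = m+n≤o⇒m≤o∸n 1 (begin
    1 + childSum u (quota R)               ≡⟨ cong (_+ childSum u (quota R)) (n/n≡1 m) ⟨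
    m / m + childSum u (quota R)           ≤⟨ +-monoˡ-≤ _ (/-monoˡ-≤ m m≤count) ⟩
    count R u / m + childSum u (quota R)   ≤⟨ quota-split R u ⟩
    quota R u                              ∎)
    where open ≤-Reasoning

  ∑-demand : ∀ R → sum (demand R) ≡ r / m
  ∑-demand R = +-cancelʳ-≡ (∑[ u < n ] childSum u (quota R)) _ _ (begin
    sum (demand R) + ∑[ u < n ] childSum u (quota R)
      ≡⟨ ∑-distrib-+ (demand R) (λ u → childSum u (quota R)) ⟨
    ∑[ u < n ] (demand R u + childSum u (quota R))
      ≡⟨ sum-cong-≗ (demand+childSum R) ⟩
    sum (quota R)
      ≡⟨ ∑-telescope (quota R) ⟩
    quota R root + ∑[ u < n ] childSum u (quota R)
      ≡⟨ cong (λ l → l / m + ∑[ u < n ] childSum u (quota R)) (load-root R) ⟩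
    r / m + ∑[ u < n ] childSum u (quota R) ∎)
    where open ≡-Reasoning

  childSum-quota-⊔ : ∀ {R R′} u → Step G R R′ →
    childSum u (λ c → quota R c ⊔ quota R′ c) ≤ quota R u
  childSum-quota-⊔ {R} {R′} u moved = begin
    childSum u (λ c → quota R c ⊔ quota R′ c)
      ≤⟨ childSum-mono u (λ c → ⊔-/ m (load R c) (load R′ c)) ⟩
    childSum u (λ c → (load R c ⊔ load R′ c) / m)
      ≤⟨ childSum-/ u (λ c → load R c ⊔ load R′ c) ⟩
    childSum u (λ c → load R c ⊔ load R′ c) / m
      ≤⟨ /-monoˡ-≤ m childSum-load-⊔ ⟩
    quota R u ∎
    where
    open ≤-Reasoning
    childSum-load-⊔ : childSum u (λ c → load R c ⊔ load R′ c) ≤ load R u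
    childSum-load-⊔ = begin
      childSum u (λ c → load R c ⊔ load R′ c)
        ≤⟨ childSum-mono u (λ c → ⊔-lub (∑-mono-≤ λ i → m≤m⊔n (𝟙 (R i ⪯? c)) (𝟙 (R′ i ⪯? c)))
                                           (∑-mono-≤ λ i → m≤n⊔m (𝟙 (R i ⪯? c)) (𝟙 (R′ i ⪯? c)))) ⟩
      childSum u (λ c → ∑[ i < r ] (𝟙 (R i ⪯? c) ⊔ 𝟙 (R′ i ⪯? c)))
        ≡⟨ childSum-∑ u (λ i c → 𝟙 (R i ⪯? c) ⊔ 𝟙 (R′ i ⪯? c)) ⟩
      ∑[ i < r ] childSum u (λ c → 𝟙 (R i ⪯? c) ⊔ 𝟙 (R′ i ⪯? c))
        ≤⟨ ∑-mono-≤ (λ i → childSum-⪯-⊔ u (moved i)) ⟩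
      load R u ∎

  open Transport (λ a b → b ≡ a ⊎ Adj G a b) (inj₁ refl)

  module Response (R R′ : Pos n r) where

    up down : Fin n → ℕ
    up   c = quota R c ∸ quota R′ c
    down c = quota R′ c ∸ quota R c

    -- up c spies climb from c to its parent and down c spies descend from the parent to c
    response : Moves
    response a b = 𝟙 (child? b a) * up a + 𝟙 (child? a b) * down b

    outflow-response : ∀ a → outflow response a ≡ nonRoot a * up a + childSum a down
    outflow-response a = trans (∑-distrib-+ (λ b → 𝟙 (child? b a) * up a) (λ b → 𝟙 (child? a b) * down b))
                               (cong (_+ childSum a down) (∑-parent a (up a)))

    inflow-response : ∀ b → inflow response b ≡ childSum b up + nonRoot b * down b
    inflow-response b = trans (∑-distrib-+ (λ a → 𝟙 (child? b a) * up a) (λ a → 𝟙 (child? a b) * down b))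
                              (cong (childSum b up +_) (∑-parent b (down b)))

    response-admissible : Admissible response
    response-admissible a b 1≤μ with 1 ≤? 𝟙 (child? b a) * up a
    ... | yes 1≤up = let a≢ρ , pa≡b = 𝟙*-sound (child? b a) (up a) 1≤up in
                     inj₂ (subst (Adj G a) pa≡b (parent-adjacent a≢ρ))
    ... | no 1≰up  = let b≢ρ , pb≡a = 𝟙*-sound (child? a b) (down b) 1≤down in
                     inj₂ (Adj-sym G (subst (Adj G b) pb≡a (parent-adjacent b≢ρ)))
      where
      1≤down : 1 ≤ 𝟙 (child? a b) * down b
      1≤down = subst (λ t → 1 ≤ t + 𝟙 (child? a b) * down b) (n<1⇒n≡0 (≰⇒> 1≰up)) 1≤μ

    outflow≤demand : Step G R R′ → ∀ u → outflow response u ≤ demand R u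
    outflow≤demand moved u = begin
      outflow response u                        ≡⟨ outflow-response u ⟩
      nonRoot u * up u + childSum u down        ≤⟨ m+n≤o⇒m≤o∸n _ (begin
        nonRoot u * up u + childSum u down + childSum u (quota R)
          ≡⟨ regroup (nonRoot u * up u) (childSum u down) (childSum u (quota R)) ⟩
        nonRoot u * up u + (childSum u (quota R) + childSum u down)
          ≡⟨ cong (nonRoot u * up u +_) (trans (sym ⊔-form) (childSum-+ u (quota R) down)) ⟨
        nonRoot u * up u + childSum u (λ c → quota R c ⊔ quota R′ c)
          ≤⟨ +-monoˡ-≤ _ (≤-trans (*-monoˡ-≤ (up u) (𝟙≤1 (¬? (root ≟ u))))
                                  (≤-reflexive (*-identityˡ (up u)))) ⟩
        up u + childSum u (λ c → quota R c ⊔ quota R′ c)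
          ≤⟨ [m∸n]+o≤m (quota R u) (quota R′ u) _ (childSum-quota-⊔ u moved) ≤quota′ ⟩
        quota R u ∎) ⟩
      demand R u                                ∎
      where
      open ≤-Reasoning
      regroup : ∀ a b c → a + b + c ≡ a + (c + b)
      regroup = solve-∀
      ⊔-form : childSum u (λ c → quota R c + down c) ≡ childSum u (λ c → quota R c ⊔ quota R′ c)
      ⊔-form = sum-cong-≗ λ c → cong (𝟙 (child? u c) *_) (m+[n∸m]≡m⊔n (quota R c) (quota R′ c))
      ≤quota′ : childSum u (λ c → quota R c ⊔ quota R′ c) ≤ quota R′ u
      ≤quota′ = ≤-trans
        (≤-reflexive (sum-cong-≗ λ c → cong (𝟙 (child? u c) *_) (⊔-comm (quota R c) (quota R′ c))))
        (childSum-quota-⊔ u (Step-sym G moved))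

    response-balance : ∀ v → demand R v + inflow response v ≡ demand R′ v + outflow response v
    response-balance v = begin
      demand R v + inflow response v                      ≡⟨ cong (demand R v +_) (inflow-response v) ⟩
      demand R v + (childSum v up + nonRoot v * down v)
        ≡⟨ transfer-balance {F = childSum v (quota R)} {F′ = childSum v (quota R′)} {D = childSum v down}
             {U = childSum v up} (demand+childSum R v) (demand+childSum R′ v) (quotas (root ≟ v)) children ⟩
      demand R′ v + (nonRoot v * up v + childSum v down)  ≡⟨ cong (demand R′ v +_) (outflow-response v) ⟨
      demand R′ v + outflow response v                    ∎
      where
      open ≡-Reasoning
      quotas : (ρ≟v : Dec (root ≡ v)) →
        quota R v + 𝟙 (¬? ρ≟v) * down v ≡ quota R′ v + 𝟙 (¬? ρ≟v) * up v
      quotas (yes refl) = cong (λ l → l / m + 0) (trans (load-root R) (sym (load-root R′)))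
      quotas (no _)     = trans (cong (quota R v +_) (*-identityˡ (down v)))
                            (trans (m+[n∸m]≡n+[m∸n] (quota R v) (quota R′ v))
                              (cong (quota R′ v +_) (sym (*-identityˡ (up v)))))
      children : childSum v (quota R) + childSum v down ≡ childSum v (quota R′) + childSum v up
      children = trans (sym (childSum-+ v (quota R) down))
                   (trans (sum-cong-≗ λ c → cong (𝟙 (child? v c) *_) (m+[n∸m]≡n+[m∸n] (quota R c) (quota R′ c)))
                     (childSum-+ v (quota R′) up))

  respond : ∀ {s} {R R′ : Pos n r} {S : Pos n s} → Step G R R′ → Guarded R S →
    Σ (Pos n s) λ S′ → Step G S S′ × Guarded R′ S′
  respond {R = R} {R′} {S} moved guarded
    with transport S response response-admissible (λ u → ≤-trans (outflow≤demand moved u) (guarded u))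
    where open Response R R′
  ... | S′ , moves , balance = S′ , moves , λ v → +-cancelʳ-≤ (outflow response v) _ _ (begin
    demand R′ v + outflow response v   ≡⟨ response-balance v ⟨
    demand R v + inflow response v     ≤⟨ +-monoˡ-≤ (inflow response v) (guarded v) ⟩
    count S v + inflow response v      ≡⟨ balance v ⟨
    count S′ v + outflow response v    ∎)
    where
    open Response R R′
    open ≤-Reasoning

  initial : ∀ {s} → r / m ≤ s → ∀ R → Σ (Pos n s) (Guarded R)
  initial r/m≤s R = place root (demand R) (≤-trans (≤-reflexive (∑-demand R)) r/m≤s)

  guarded⇒safe : ∀ {s} {R : Pos n r} {S : Pos n s} → Guarded R S → ¬ UnguardedMeeting m R S
  guarded⇒safe {R = R} {S} guarded (v , m≤countAt , unguarded) with
    count-pos S v (≤-trans (meeting⇒demand R v (subst (m ≤_) (countAt≡count R v) m≤countAt)) (guarded v))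
  ... | j , Sj≡v = unguarded j Sj≡v

theorem1 : ∀ {n} (G : Graph n) → IsTree G →
    (m r s : ℕ) → .{{_ : NonZero m}} → 1 ≤ r →
    r / m ≤ s → SpiesWin G m r s
theorem1 G tree m r s _ r/m≤s =
  Guarded , initial r/m≤s , (λ _ _ → guarded⇒safe) , (λ _ _ guarded _ moved → respond moved guarded)
  where open Strategy (tree⇒rooted tree) m {r}
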